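{- Let $\sigma\ell\mathbb{G}_u$ be the category whose objects are Dedekind $\sigma$-complete $\ell$-groups with a designated weak unit $1$ and whose morphisms are $\sigma$-continuous $\ell$-morphisms preserving the designated weak unit, and let $\mathcal{V}_{\sigma\ell\mathbb{G}_u}$ be the infinitary variety described in the context. Define $U_u\colon\mathcal{V}_{\sigma\ell\mathbb{G}_u}\to\sigma\ell\mathbb{G}_u$ sending $G$ to its underlying $\ell$-group with the interpretation of $1$ as designated weak unit (forgetting $\bigvee^-$), and $F_u\colon\sigma\ell\mathbb{G}_u\to\mathcal{V}_{\sigma\ell\mathbb{G}_u}$ sending $G$ to $G$ with its $\ell$-group operations, $\bigvee_{n\ge1}^g f_n:=\sup_{n\ge1}\{f_n\wedge g\}$ and $1$ interpreted as the designated weak unit; both act as the identity on morphisms. Then $U_u$ and $F_u$ are well-defined functors and are inverse to each other; in particular the category of Dedekind $\sigma$-complete $\ell$-groups with weak unit is an infinitary variety.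
   Context: An $\ell$-group $G$ is Dedekind $\sigma$-complete if every countable subset bounded above has a supremum. $\sigma$-continuous means preserving existing countable suprema. An element $1$ of an $\ell$-group is a weak unit if $1\ge0$ and $f\wedge1=0$ implies $f=0$. $\mathcal{V}_{\sigma\ell\mathbb{G}_u}$ has operations $0,+,-,\vee,\wedge$, a constant $1$, and a countably infinitary operation $\bigvee^-$ written $\bigvee_{n\ge1}^g f_n:=\bigvee^-(g,f_1,f_2,\dots)$; its axioms are the $\ell$-group axioms, (A1) $\bigvee_{n\ge1}^g f_n=\bigvee_{n\ge1}^g(f_n\wedge g)$; (A2) $\bigvee_{n\ge1}^g f_n=(f_1\wedge g)\vee\bigvee_{n\ge2}^g f_n$; (A3) $\bigvee_{n\ge1}^g(f_n\wedge h)\le h$ ($a\le b$ means $a\wedge b=a$), and $\bigvee_{n\ge1}^{|f|}(|f|\wedge n1)=|f|$. Morphisms preserve all operations. -}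

module Defs where

open import Level using (Level; _⊔_; suc)
open import Data.Nat using (ℕ; zero) renaming (suc to sucℕ)
open import Data.Product using (Σ; _×_; _,_; proj₁; proj₂)
open import Relation.Binary.Core using (Rel)
open import Relation.Binary.Structures using (IsEquivalence)
open import Algebra.Structures using (IsGroup)
open import Algebra.Lattice.Structures using (IsLattice)

record LGroup (c ℓ : Level) : Set (suc (c ⊔ ℓ)) where
  infix  4 _≈_ _≤_
  infixl 6 _+_
  infixr 7 _∧_
  infixr 6 _∨_
  field
    Carrier   : Set c
    _≈_       : Rel Carrier ℓ
    _+_       : Carrier → Carrier → Carrier
    0#        : Carrier
    -_        : Carrier → Carrier
    _∨_       : Carrier → Carrier → Carrier
    _∧_       : Carrier → Carrier → Carrier
    isGroup   : IsGroup _≈_ _+_ 0# -_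
    isLattice : IsLattice _≈_ _∨_ _∧_
    +-distribˡ-∨ : ∀ a b c → (a + (b ∨ c)) ≈ ((a + b) ∨ (a + c))
    +-distribʳ-∨ : ∀ a b c → ((b ∨ c) + a) ≈ ((b + a) ∨ (c + a))

  _≤_ : Carrier → Carrier → Set ℓ
  a ≤ b = (a ∧ b) ≈ a

  ∣_∣ : Carrier → Carrier
  ∣ f ∣ = f ∨ (- f)

  _·_ : ℕ → Carrier → Carrier
  zero   · e = 0#
  sucℕ n · e = (n · e) + e

  IsSup : (ℕ → Carrier) → Carrier → Set (c ⊔ ℓ)
  IsSup f s = (∀ n → f n ≤ s) × (∀ u → (∀ n → f n ≤ u) → s ≤ u)

  IsUpperBound : (ℕ → Carrier) → Carrier → Set ℓ
  IsUpperBound f u = ∀ n → f n ≤ u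

  DedekindσComplete : Set (c ⊔ ℓ)
  DedekindσComplete =
    (f : ℕ → Carrier) → Σ Carrier (IsUpperBound f) → Σ Carrier (IsSup f)

  IsWeakUnit : Carrier → Set (c ⊔ ℓ)
  IsWeakUnit e = (0# ≤ e) × (∀ f → (f ∧ e) ≈ 0# → f ≈ 0#)

  open IsGroup isGroup public
    using (refl; sym; trans; ∙-cong; ⁻¹-cong)
  open IsLattice isLattice public
    using (∧-cong; ∨-cong; ∧-assoc; ∧-comm; absorptive)


record SigmaLGu (c ℓ : Level) : Set (suc (c ⊔ ℓ)) where
  field
    lgroup     : LGroup c ℓ
    unit       : LGroup.Carrier lgroup
    isWeakUnit : LGroup.IsWeakUnit lgroup unit
    σcomplete  : LGroup.DedekindσComplete lgroup

-- Objects of the infinitary variety V_{σℓG_u}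
-- bigvee g f  stands for  ⋁^g_{n≥1} f_n  (with f indexed from 0 here).

module _ {c ℓ} (G : LGroup c ℓ) where
  open LGroup G

  record IsVAlg (one : Carrier) (⋁ : Carrier → (ℕ → Carrier) → Carrier)
         : Set (c ⊔ ℓ) where
    field
      ⋁-cong : ∀ {g g′} {f f′ : ℕ → Carrier} →
               g ≈ g′ → (∀ n → f n ≈ f′ n) → ⋁ g f ≈ ⋁ g′ f′
      A1 : ∀ g f → ⋁ g f ≈ ⋁ g (λ n → f n ∧ g)
      A2 : ∀ g f → ⋁ g f ≈ ((f 0 ∧ g) ∨ ⋁ g (λ n → f (sucℕ n)))
      A3 : ∀ g h (f : ℕ → Carrier) → ⋁ g (λ n → f n ∧ h) ≤ h
      A4 : ∀ f → ⋁ ∣ f ∣ (λ n → ∣ f ∣ ∧ (sucℕ n · one)) ≈ ∣ f ∣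

record VAlg (c ℓ : Level) : Set (suc (c ⊔ ℓ)) where
  field
    lgroup  : LGroup c ℓ
    one     : LGroup.Carrier lgroup
    ⋁       : LGroup.Carrier lgroup → (ℕ → LGroup.Carrier lgroup) → LGroup.Carrier lgroup
    isVAlg  : IsVAlg lgroup one ⋁

module _ {c₁ ℓ₁ c₂ ℓ₂} (G : LGroup c₁ ℓ₁) (H : LGroup c₂ ℓ₂) where
  private
    module G = LGroup G
    module H = LGroup H

  record IsLHom (h : G.Carrier → H.Carrier) : Set (c₁ ⊔ ℓ₁ ⊔ ℓ₂) where
    field
      cong  : ∀ {a b} → a G.≈ b → h a H.≈ h b
      hom-+ : ∀ a b → h (a G.+ b) H.≈ (h a H.+ h b)
      hom-0 : h G.0# H.≈ H.0#
      hom-- : ∀ a → h (G.- a) H.≈ (H.- h a)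
      hom-∨ : ∀ a b → h (a G.∨ b) H.≈ (h a H.∨ h b)
      hom-∧ : ∀ a b → h (a G.∧ b) H.≈ (h a H.∧ h b)

  IsσContinuous : (G.Carrier → H.Carrier) → Set (c₁ ⊔ ℓ₁ ⊔ c₂ ⊔ ℓ₂)
  IsσContinuous h = ∀ (f : ℕ → G.Carrier) s → G.IsSup f s → H.IsSup (λ n → h (f n)) (h s)

  IsSigmaHom : G.Carrier → H.Carrier → (G.Carrier → H.Carrier) → Set (c₁ ⊔ ℓ₁ ⊔ c₂ ⊔ ℓ₂)
  IsSigmaHom uG uH h = IsLHom h × IsσContinuous h × (h uG H.≈ uH)

  IsVHom : G.Carrier → (G.Carrier → (ℕ → G.Carrier) → G.Carrier) →
           H.Carrier → (H.Carrier → (ℕ → H.Carrier) → H.Carrier) →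
           (G.Carrier → H.Carrier) → Set (c₁ ⊔ ℓ₁ ⊔ ℓ₂)
  IsVHom oneG ⋁G oneH ⋁H h =
    IsLHom h × (h oneG H.≈ oneH) × (∀ g f → h (⋁G g f) H.≈ ⋁H (h g) (λ n → h (f n)))

-- The operation ⋁^- that F_u puts on a σℓG_u object:
--   ⋁^g f := sup_n (f n ∧ g)   (the supremum chosen by σ-completeness)

module _ {c ℓ} (G : SigmaLGu c ℓ) where
  open SigmaLGu G
  open LGroup lgroup

  ∧-bounded : ∀ (f : ℕ → Carrier) g → IsUpperBound (λ n → f n ∧ g) g
  ∧-bounded f g n =
    trans (∧-assoc (f n) g g)
          (∧-cong (refl {f n}) (trans (∧-cong (refl {g}) (sym (absorptive .proj₁ g g)))
                                      (absorptive .proj₂ g (g ∧ g))))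

  Fsup : Carrier → (ℕ → Carrier) → Carrier
  Fsup g f = proj₁ (σcomplete (λ n → f n ∧ g) (g , ∧-bounded f g))

-- In a V-algebra, A2 makes ⋁^g f an upper bound of the f n ∧ g and A1, A3 make it the least one,
-- so V-algebras are σ-complete and V-morphisms are σ-continuous. A4 then says that ∣f∣ is the
-- supremum of the ∣f∣ ∧ n·1; as 0 ∧ n·x ≤ x in every ℓ-group, and f ∧ 1 = 0 forces f ∧ n·1 ≤ 0,
-- this makes 1 a positive weak unit.
-- Conversely, in an ℓ-group with weak unit e, if s = sup (a ∧ n·e) then w = (-s + a) ∧ e satisfies
-- a ∧ n·e + w ≤ a ∧ (n+1)·e ≤ s, whence s + w ≤ s, w = 0 and s = a: this is A4 for the supremum
-- operation of a σ-complete ℓ-group, while A1–A3 are generalities about suprema.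
module Submission where

open import Defs
open import Data.Nat using (ℕ; zero; suc)
open import Data.Product using (_×_; _,_; proj₁; proj₂)
open import Function using (_∘_)
open import Algebra.Bundles using (Group)
open import Algebra.Structures using (IsGroup)
open import Algebra.Lattice.Structures using (IsLattice)
import Algebra.Lattice.Bundles as Alg
import Algebra.Lattice.Properties.Lattice as AlgLatticeProperties
import Algebra.Properties.Group as GroupProperties
import Relation.Binary.Lattice as Ord
import Relation.Binary.Lattice.Properties.JoinSemilattice as JoinSemilatticeProperties
import Relation.Binary.Lattice.Properties.MeetSemilattice as MeetSemilatticeProperties
import Relation.Binary.Reasoning.PartialOrder as ≤-Reasoning

module LGroupProperties {c ℓ} (G : LGroup c ℓ) where
  open LGroup G public
  open IsGroup isGroup using (isEquivalence; identityˡ; identityʳ; inverseˡ; inverseʳ)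
  open IsLattice isLattice using (∨-comm)

  group : Group c ℓ
  group = record { isGroup = isGroup }

  open GroupProperties group using (\\-leftDividesˡ; \\-leftDividesʳ; //-rightDividesˡ; //-rightDividesʳ; ε⁻¹≈ε)

  algLattice : Alg.Lattice c ℓ
  algLattice = record { isLattice = isLattice }

  private
    module Lib≤ = Ord.Lattice (AlgLatticeProperties.∨-∧-orderTheoreticLattice algLattice)

  -- The library orders an algebraic lattice by x ≈ x ∧ y; Defs uses the symmetric x ∧ y ≈ x,
  -- and below a proof of x ≤ y is often used directly as that equation.
  orderLattice : Ord.Lattice c ℓ ℓ
  orderLattice = record
    { _≤_       = _≤_
    ; isLattice = record
      { isPartialOrder = record
        { isPreorder = record
          { isEquivalence = isEquivalence
          ; reflexive     = λ p → sym (Lib≤.reflexive p)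
          ; trans         = λ p q → sym (Lib≤.trans (sym p) (sym q))
          }
        ; antisym = λ p q → Lib≤.antisym (sym p) (sym q)
        }
      ; supremum = λ x y →
          sym (Lib≤.x≤x∨y x y) , sym (Lib≤.y≤x∨y x y) , λ z p q → sym (Lib≤.∨-least (sym p) (sym q))
      ; infimum  = λ x y →
          sym (Lib≤.x∧y≤x x y) , sym (Lib≤.x∧y≤y x y) , λ z p q → sym (Lib≤.∧-greatest (sym p) (sym q))
      }
    }

  open Ord.Lattice orderLattice public
    using (poset; x≤x∨y; y≤x∨y; ∨-least; x∧y≤x; x∧y≤y; ∧-greatest; antisym; ≤-respˡ-≈; ≤-respʳ-≈)
    renaming (refl to ≤-refl; reflexive to ≤-reflexive; trans to ≤-trans)
  open JoinSemilatticeProperties (Ord.Lattice.joinSemilattice orderLattice) public using (x≤y⇒x∨y≈y)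
  open MeetSemilatticeProperties (Ord.Lattice.meetSemilattice orderLattice) public using (∧-monotonic)
  open ≤-Reasoning poset

  x∨y≈y⇒x≤y : ∀ {x y} → (x ∨ y) ≈ y → x ≤ y
  x∨y≈y⇒x≤y {x} {y} p = ≤-respʳ-≈ p (x≤x∨y x y)

  +-monoˡ-≤ : ∀ z {x y} → x ≤ y → z + x ≤ z + y
  +-monoˡ-≤ z {x} {y} x≤y = x∨y≈y⇒x≤y (trans (sym (+-distribˡ-∨ z x y)) (∙-cong refl (x≤y⇒x∨y≈y x≤y)))

  +-monoʳ-≤ : ∀ z {x y} → x ≤ y → x + z ≤ y + z
  +-monoʳ-≤ z {x} {y} x≤y = x∨y≈y⇒x≤y (trans (sym (+-distribʳ-∨ z x y)) (∙-cong (x≤y⇒x∨y≈y x≤y) refl))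

  +-mono-≤ : ∀ {x y u v} → x ≤ y → u ≤ v → x + u ≤ y + v
  +-mono-≤ {y = y} {u} x≤y u≤v = ≤-trans (+-monoʳ-≤ u x≤y) (+-monoˡ-≤ y u≤v)

  +-cancelˡ-≤ : ∀ z {x y} → z + x ≤ z + y → x ≤ y
  +-cancelˡ-≤ z {x} {y} p = begin
    x              ≈⟨ \\-leftDividesʳ z x ⟨
    - z + (z + x)  ≤⟨ +-monoˡ-≤ (- z) p ⟩
    - z + (z + y)  ≈⟨ \\-leftDividesʳ z y ⟩
    y              ∎

  +-cancelʳ-≤ : ∀ z {x y} → x + z ≤ y + z → x ≤ y
  +-cancelʳ-≤ z {x} {y} p = begin
    x              ≈⟨ //-rightDividesʳ z x ⟨
    (x + z) + - z  ≤⟨ +-monoʳ-≤ (- z) p ⟩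
    (y + z) + - z  ≈⟨ //-rightDividesʳ z y ⟩
    y              ∎

  -‿antimono-≤ : ∀ {x y} → x ≤ y → - y ≤ - x
  -‿antimono-≤ {x} {y} x≤y = +-cancelˡ-≤ y (begin
    y + - y  ≈⟨ inverseʳ y ⟩
    0#       ≈⟨ inverseʳ x ⟨
    x + - x  ≤⟨ +-monoʳ-≤ (- x) x≤y ⟩
    y + - x  ∎)

  +-distribʳ-∧ : ∀ z x y → (x ∧ y) + z ≈ (x + z) ∧ (y + z)
  +-distribʳ-∧ z x y = antisym
    (∧-greatest (+-monoʳ-≤ z (x∧y≤x x y)) (+-monoʳ-≤ z (x∧y≤y x y)))
    (begin
      m              ≈⟨ //-rightDividesˡ z m ⟨
      (m + - z) + z  ≤⟨ +-monoʳ-≤ z (∧-greatest (below (x∧y≤x _ _)) (below (x∧y≤y _ _))) ⟩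
      (x ∧ y) + z    ∎)
    where
    m : Carrier
    m = (x + z) ∧ (y + z)
    below : ∀ {u} → m ≤ u + z → m + - z ≤ u
    below {u} p = +-cancelʳ-≤ z (≤-respˡ-≈ (sym (//-rightDividesˡ z m)) p)

  0≤x⇒∣x∣≈x : ∀ {x} → 0# ≤ x → ∣ x ∣ ≈ x
  0≤x⇒∣x∣≈x {x} 0≤x = trans (∨-comm x (- x)) (x≤y⇒x∨y≈y -x≤x)
    where
    -x≤x : - x ≤ x
    -x≤x = ≤-trans (≤-respʳ-≈ ε⁻¹≈ε (-‿antimono-≤ 0≤x)) 0≤x

  -[0∧x]∧x≤0 : ∀ x → - (0# ∧ x) ∧ x ≤ 0#
  -[0∧x]∧x≤0 x = +-cancelʳ-≤ m (begin
    (- m ∧ x) + m        ≈⟨ +-distribʳ-∧ m (- m) x ⟩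
    (- m + m) ∧ (x + m)  ≈⟨ ∧-cong (inverseˡ m) refl ⟩
    0# ∧ (x + m)         ≤⟨ ∧-monotonic ≤-refl x+m≤x ⟩
    m                    ≈⟨ identityˡ m ⟨
    0# + m               ∎)
    where
    m : Carrier
    m = 0# ∧ x
    x+m≤x : x + m ≤ x
    x+m≤x = ≤-respʳ-≈ (identityʳ x) (+-monoˡ-≤ x (x∧y≤x 0# x))

  0∧x≤y⇒0∧[x+y]≤y : ∀ {x y} → 0# ∧ x ≤ y → 0# ∧ (x + y) ≤ y
  0∧x≤y⇒0∧[x+y]≤y {x} {y} p = +-cancelʳ-≤ (- y) (begin
    (0# ∧ (x + y)) + - y          ≈⟨ +-distribʳ-∧ (- y) 0# (x + y) ⟩
    (0# + - y) ∧ ((x + y) + - y)  ≈⟨ ∧-cong (identityˡ (- y)) (//-rightDividesʳ y x) ⟩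
    - y ∧ x                       ≤⟨ ∧-monotonic (-‿antimono-≤ p) ≤-refl ⟩
    - (0# ∧ x) ∧ x                ≤⟨ -[0∧x]∧x≤0 x ⟩
    0#                            ≈⟨ inverseʳ y ⟨
    y + - y                       ∎)

  0∧[1+n]·x≤x : ∀ n x → 0# ∧ (suc n · x) ≤ x
  0∧[1+n]·x≤x zero    x = ≤-respʳ-≈ (identityˡ x) (x∧y≤y 0# (0# + x))
  0∧[1+n]·x≤x (suc n) x = 0∧x≤y⇒0∧[x+y]≤y (0∧[1+n]·x≤x n x)

  x∧y≈0⇒x∧[1+n]·y≤0 : ∀ {x y} → 0# ≤ y → x ∧ y ≈ 0# → ∀ n → x ∧ (suc n · y) ≤ 0#
  x∧y≈0⇒x∧[1+n]·y≤0 {x} {y} 0≤y x∧y≈0 = bound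
    where
    x≤x+y : x ≤ x + y
    x≤x+y = ≤-respˡ-≈ (identityʳ x) (+-monoˡ-≤ x 0≤y)
    bound : ∀ n → x ∧ (suc n · y) ≤ 0#
    bound zero    = ≤-reflexive (trans (∧-cong refl (identityˡ y)) x∧y≈0)
    bound (suc n) = ≤-respʳ-≈ x∧y≈0 (∧-greatest (x∧y≤x _ _) (begin
      x ∧ ((suc n · y) + y)        ≤⟨ ∧-monotonic x≤x+y ≤-refl ⟩
      (x + y) ∧ ((suc n · y) + y)  ≈⟨ +-distribʳ-∧ y x (suc n · y) ⟨
      (x ∧ (suc n · y)) + y        ≤⟨ +-monoʳ-≤ y (bound n) ⟩
      0# + y                       ≈⟨ identityˡ y ⟩
      y                            ∎))

  IsSup-resp : ∀ {f g : ℕ → Carrier} {s t} → (∀ n → f n ≈ g n) → s ≈ t → IsSup f s → IsSup g t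
  IsSup-resp f≈g s≈t (upper , least) =
    (λ n → ≤-resp-≈ (f≈g n) s≈t (upper n)) ,
    (λ u g≤u → ≤-respˡ-≈ s≈t (least u (λ n → ≤-respˡ-≈ (sym (f≈g n)) (g≤u n))))
    where
    ≤-resp-≈ : ∀ {x x′ y y′} → x ≈ x′ → y ≈ y′ → x ≤ y → x′ ≤ y′
    ≤-resp-≈ p q = ≤-respˡ-≈ p ∘ ≤-respʳ-≈ q

  IsSup-unique : ∀ {f g : ℕ → Carrier} {s t} → (∀ n → f n ≈ g n) → IsSup f s → IsSup g t → s ≈ t
  IsSup-unique f≈g S (upper , least) =
    let (upper′ , least′) = IsSup-resp f≈g refl S
    in antisym (least′ _ upper) (least _ upper′)

  IsSup-cons : ∀ {f : ℕ → Carrier} {t} → IsSup (λ n → f (suc n)) t → IsSup f (f 0 ∨ t)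
  IsSup-cons {f} {t} (upper , least) = upper′ , λ u f≤u → ∨-least (f≤u 0) (least u (λ n → f≤u (suc n)))
    where
    upper′ : ∀ n → f n ≤ f 0 ∨ t
    upper′ zero    = x≤x∨y _ _
    upper′ (suc n) = ≤-trans (upper n) (y≤x∨y _ _)

  IsWeakUnit⇒sup[x∧[1+n]·e]≈x : ∀ {e x s} → IsWeakUnit e → IsSup (λ n → x ∧ (suc n · e)) s → s ≈ x
  IsWeakUnit⇒sup[x∧[1+n]·e]≈x {e} {x} {s} (0≤e , weak) (upper , least) = begin-equality
    s       ≈⟨ identityʳ s ⟨
    s + 0#  ≈⟨ ∙-cong refl (sym (weak d (antisym w≤0 0≤w))) ⟩
    s + d   ≈⟨ \\-leftDividesˡ s x ⟩
    x       ∎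
    where
    F : ℕ → Carrier
    F n = x ∧ (suc n · e)
    d w : Carrier
    d = - s + x
    w = d ∧ e
    0≤d : 0# ≤ d
    0≤d = +-cancelˡ-≤ s (begin
      s + 0#  ≈⟨ identityʳ s ⟩
      s       ≤⟨ least x (λ n → x∧y≤x x _) ⟩
      x       ≈⟨ \\-leftDividesˡ s x ⟨
      s + d   ∎)
    0≤w : 0# ≤ w
    0≤w = ∧-greatest 0≤d 0≤e
    F+w≤F : ∀ n → F n + w ≤ F (suc n)
    F+w≤F n = ∧-greatest (≤-respʳ-≈ (\\-leftDividesˡ s x) (+-mono-≤ (upper n) (x∧y≤x d e)))
                         (+-mono-≤ (x∧y≤y x _) (x∧y≤y d e))
    F≤s-w : ∀ n → F n ≤ s + - w
    F≤s-w n = +-cancelʳ-≤ w (begin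
      F n + w          ≤⟨ F+w≤F n ⟩
      F (suc n)        ≤⟨ upper (suc n) ⟩
      s                ≈⟨ //-rightDividesˡ w s ⟨
      (s + - w) + w    ∎)
    w≤0 : w ≤ 0#
    w≤0 = +-cancelˡ-≤ s (begin
      s + w            ≤⟨ +-monoʳ-≤ w (least (s + - w) F≤s-w) ⟩
      (s + - w) + w    ≈⟨ //-rightDividesˡ w s ⟩
      s                ≈⟨ identityʳ s ⟨
      s + 0#           ∎)

module VAlgProperties {c ℓ} (V : VAlg c ℓ) where
  open VAlg V
  open LGroupProperties lgroup
  open IsVAlg isVAlg
  open ≤-Reasoning poset

  ⋁-isSup : ∀ g f → IsSup (λ n → f n ∧ g) (⋁ g f)
  ⋁-isSup g f = upper f , least
    where
    upper : ∀ f n → f n ∧ g ≤ ⋁ g f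
    upper f zero    = ≤-respʳ-≈ (sym (A2 g f)) (x≤x∨y _ _)
    upper f (suc n) = ≤-respʳ-≈ (sym (A2 g f)) (≤-trans (upper (λ n → f (suc n)) n) (y≤x∨y _ _))
    least : ∀ u → (∀ n → f n ∧ g ≤ u) → ⋁ g f ≤ u
    least u f∧g≤u = ≤-respˡ-≈ (sym (trans (A1 g f) (⋁-cong refl (λ n → sym (f∧g≤u n))))) (A3 g u _)

  σcomplete : DedekindσComplete
  σcomplete f (u , f≤u) = ⋁ u f , IsSup-resp f≤u refl (⋁-isSup u f)

  ∣x∣∧[1+n]·one≤u⇒∣x∣≤u : ∀ {x u} → (∀ n → ∣ x ∣ ∧ (suc n · one) ≤ u) → ∣ x ∣ ≤ u
  ∣x∣∧[1+n]·one≤u⇒∣x∣≤u {x} {u} bound =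
    ≤-respˡ-≈ (A4 x) (proj₂ (⋁-isSup ∣ x ∣ _) u (λ n → ≤-trans (x∧y≤x _ _) (bound n)))

  0≤one : 0# ≤ one
  0≤one = begin
    0#        ≈⟨ ∣0∣≈0 ⟨
    ∣ 0# ∣    ≤⟨ ∣x∣∧[1+n]·one≤u⇒∣x∣≤u bound ⟩
    0# ∧ one  ≤⟨ x∧y≤y _ _ ⟩
    one       ∎
    where
    ∣0∣≈0 : ∣ 0# ∣ ≈ 0#
    ∣0∣≈0 = 0≤x⇒∣x∣≈x ≤-refl
    bound : ∀ n → ∣ 0# ∣ ∧ (suc n · one) ≤ 0# ∧ one
    bound n = ∧-greatest (≤-trans (x∧y≤x _ _) (≤-reflexive ∣0∣≈0))
      (≤-trans (∧-monotonic (≤-reflexive ∣0∣≈0) ≤-refl) (0∧[1+n]·x≤x n one))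

  one-isWeakUnit : IsWeakUnit one
  one-isWeakUnit = 0≤one , λ x x∧one≈0 →
    let 0≤x     = ≤-respˡ-≈ x∧one≈0 (x∧y≤x x one)
        ∣x∣≈x   = 0≤x⇒∣x∣≈x 0≤x
        bound n = ≤-trans (∧-monotonic (≤-reflexive ∣x∣≈x) ≤-refl) (x∧y≈0⇒x∧[1+n]·y≤0 0≤one x∧one≈0 n)
    in antisym (≤-respˡ-≈ ∣x∣≈x (∣x∣∧[1+n]·one≤u⇒∣x∣≤u bound)) 0≤x

module SigmaLGuProperties {c ℓ} (G : SigmaLGu c ℓ) where
  open SigmaLGu G
  open LGroupProperties lgroup

  Fsup-isSup : ∀ g f → IsSup (λ n → f n ∧ g) (Fsup G g f)
  Fsup-isSup g f = proj₂ (σcomplete (λ n → f n ∧ g) (g , ∧-bounded G f g))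

  Fsup-isVAlg : IsVAlg lgroup unit (Fsup G)
  Fsup-isVAlg = record
    { ⋁-cong = λ g≈g′ f≈f′ → IsSup-unique (λ n → ∧-cong (f≈f′ n) g≈g′) (Fsup-isSup _ _) (Fsup-isSup _ _)
    ; A1     = λ g f → IsSup-unique (λ n → sym (x∧y≤y (f n) g)) (Fsup-isSup g f) (Fsup-isSup g _)
    ; A2     = λ g f → IsSup-unique (λ n → refl) (Fsup-isSup g f) (IsSup-cons (Fsup-isSup g _))
    ; A3     = λ g h f → proj₂ (Fsup-isSup g (λ n → f n ∧ h)) h (λ n → ≤-trans (x∧y≤x _ _) (x∧y≤y _ _))
    ; A4     = λ f → IsWeakUnit⇒sup[x∧[1+n]·e]≈x isWeakUnit
                       (IsSup-resp (λ n → x∧y≤x ∣ f ∣ _) refl (Fsup-isSup ∣ f ∣ _))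
    }

VHom⇒SigmaHom : ∀ {c₁ ℓ₁ c₂ ℓ₂} (G : VAlg c₁ ℓ₁) (H : VAlg c₂ ℓ₂)
  (h : LGroup.Carrier (VAlg.lgroup G) → LGroup.Carrier (VAlg.lgroup H)) →
  IsVHom (VAlg.lgroup G) (VAlg.lgroup H) (VAlg.one G) (VAlg.⋁ G) (VAlg.one H) (VAlg.⋁ H) h →
  IsSigmaHom (VAlg.lgroup G) (VAlg.lgroup H) (VAlg.one G) (VAlg.one H) h
VHom⇒SigmaHom G H h (isLHom , h-one , h-⋁) = isLHom , σcontinuous , h-one
  where
  module G = LGroupProperties (VAlg.lgroup G)
  module H = LGroupProperties (VAlg.lgroup H)
  open IsLHom isLHom
  σcontinuous : IsσContinuous (VAlg.lgroup G) (VAlg.lgroup H) h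
  σcontinuous f s sup-f = H.IsSup-resp
    (λ n → H.trans (H.sym (hom-∧ (f n) s)) (cong (proj₁ sup-f n)))
    (H.trans (H.sym (h-⋁ s f)) (cong s≈⋁))
    (VAlgProperties.⋁-isSup H (h s) (λ n → h (f n)))
    where
    s≈⋁ : VAlg.⋁ G s f G.≈ s
    s≈⋁ = G.IsSup-unique (proj₁ sup-f) (VAlgProperties.⋁-isSup G s f) sup-f

SigmaHom⇒VHom : ∀ {c₁ ℓ₁ c₂ ℓ₂} (G : SigmaLGu c₁ ℓ₁) (H : SigmaLGu c₂ ℓ₂)
  (h : LGroup.Carrier (SigmaLGu.lgroup G) → LGroup.Carrier (SigmaLGu.lgroup H)) →
  IsSigmaHom (SigmaLGu.lgroup G) (SigmaLGu.lgroup H) (SigmaLGu.unit G) (SigmaLGu.unit H) h →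
  IsVHom (SigmaLGu.lgroup G) (SigmaLGu.lgroup H) (SigmaLGu.unit G) (Fsup G) (SigmaLGu.unit H) (Fsup H) h
SigmaHom⇒VHom G H h (isLHom , σcontinuous , h-unit) = isLHom , h-unit , h-Fsup
  where
  module H = LGroupProperties (SigmaLGu.lgroup H)
  open IsLHom isLHom
  h-Fsup : ∀ g f → h (Fsup G g f) H.≈ Fsup H (h g) (λ n → h (f n))
  h-Fsup g f = H.IsSup-unique (λ n → hom-∧ (f n) g)
    (σcontinuous _ _ (SigmaLGuProperties.Fsup-isSup G g f))
    (SigmaLGuProperties.Fsup-isSup H (h g) (λ n → h (f n)))

mainTheorem4 : ∀ {c₁ ℓ₁ c₂ ℓ₂} →
    (∀ (G : VAlg c₁ ℓ₁) →
       LGroup.IsWeakUnit (VAlg.lgroup G) (VAlg.one G)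
       × LGroup.DedekindσComplete (VAlg.lgroup G))
    × (∀ (G : SigmaLGu c₁ ℓ₁) →
       IsVAlg (SigmaLGu.lgroup G) (SigmaLGu.unit G) (Fsup G))
    × (∀ (G : VAlg c₁ ℓ₁) (H : VAlg c₂ ℓ₂)
         (h : LGroup.Carrier (VAlg.lgroup G) → LGroup.Carrier (VAlg.lgroup H)) →
       IsVHom (VAlg.lgroup G) (VAlg.lgroup H)
              (VAlg.one G) (VAlg.⋁ G) (VAlg.one H) (VAlg.⋁ H) h →
       IsSigmaHom (VAlg.lgroup G) (VAlg.lgroup H) (VAlg.one G) (VAlg.one H) h)
    × (∀ (G : SigmaLGu c₁ ℓ₁) (H : SigmaLGu c₂ ℓ₂)
         (h : LGroup.Carrier (SigmaLGu.lgroup G) → LGroup.Carrier (SigmaLGu.lgroup H)) →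
       IsSigmaHom (SigmaLGu.lgroup G) (SigmaLGu.lgroup H)
                  (SigmaLGu.unit G) (SigmaLGu.unit H) h →
       IsVHom (SigmaLGu.lgroup G) (SigmaLGu.lgroup H)
              (SigmaLGu.unit G) (Fsup G) (SigmaLGu.unit H) (Fsup H) h)
    × (∀ (G : VAlg c₁ ℓ₁) (g : LGroup.Carrier (VAlg.lgroup G))
         (f : ℕ → LGroup.Carrier (VAlg.lgroup G)) →
       LGroup.IsSup (VAlg.lgroup G)
         (λ n → LGroup._∧_ (VAlg.lgroup G) (f n) g) (VAlg.⋁ G g f))
mainTheorem4 =
  (λ G → VAlgProperties.one-isWeakUnit G , VAlgProperties.σcomplete G) ,
  SigmaLGuProperties.Fsup-isVAlg ,
  VHom⇒SigmaHom ,
  SigmaHom⇒VHom ,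
  VAlgProperties.⋁-isSup
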